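{- Let $S$ be a substitution and let $X$ be a set of (abstract) variables containing every free variable of $\mathit{Mod}_X(S)$ (primed variables $x'$ being counted as their unprimed counterparts $x$). Then $\mathit{Prd}_X(S)\Leftrightarrow \mathit{Prd}_X(T_X(S))$.
   Context: Substitutions (B generalized substitutions) are built from: assignment $x:=E$; multiple assignment $x,y:=E,F$ (commutative); $\mathit{skip}$; guarded substitution $P\Rightarrow S$; bounded choice $S_1[]S_2$; local-variable substitution $@z.S$. Weakest preconditions: $[x:=E]P$ is substitution of $E$ for free $x$ in $P$ (simultaneous for multiple assignment); $[\mathit{skip}]P\Leftrightarrow P$; $[P_1\Rightarrow S]P_2\Leftrightarrow(P_1\Rightarrow[S]P_2)$; $[S_1[]S_2]P\Leftrightarrow[S_1]P\wedge[S_2]P$; $[@z.S]P\Leftrightarrow\forall z.[S]P$ ($z$ not free in $P$). Before-after predicate: for a set of variables $X$, $\mathit{Prd}_X(S)\equiv\neg[S]\neg\bigwedge_{x\in X}(x=x')$, where $x'$ denotes the after-value of $x$. Modification predicate: $\mathit{Mod}_X(S)\equiv \mathit{Prd}_X(S)\wedge\bigvee_{x\in X}(x\neq x')$ (primed variables left free). CF: conjunction of disjunctions of elementary predicates $E(Y)\,r\,F(Z)$ (expressions with variable sets $Y,Z$, relational operator $r$) or $\forall z.Q$/$\exists z.Q$ with $Q$ in CF; guards are put into CF before transformation. Predicate abstraction: $T_X(E(Y)\,r\,F(Z))=E(Y)\,r\,F(Z)$ if $Y,Z\subseteq X$, else $\mathit{true}$; $T_X(P_1\vee P_2)=T_X(P_1)\vee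 T_X(P_2)$; $T_X(P_1\wedge P_2)=T_X(P_1)\wedge T_X(P_2)$; $T_X(\alpha z.P)=\alpha z.T_{X\cup\{z\}}(P)$. Substitution abstraction: $T_X(x:=E)=\mathit{skip}$ if $x\notin X$, $x:=E$ if $x\in X$; $T_X(\mathit{skip})=\mathit{skip}$; $T_X(x,y:=E,F)$ is $\mathit{skip}$ if $x,y\notin X$, $x:=E$ if only $x\in X$ ($y:=F$ if only $y\in X$), $x,y:=E,F$ if both in $X$; $T_X(P\Rightarrow S)=T_X(P)\Rightarrow T_X(S)$; $T_X(S_1[]S_2)=T_X(S_1)[]T_X(S_2)$; $T_X(@z.S)=@z.T_{X\cup\{z\}}(S)$. -}

module Defs where

open import Level using (0ℓ)
open import Data.Nat using (ℕ)
import Data.Nat as ℕ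
open import Data.Bool using (Bool; true; false; if_then_else_; _∧_)
open import Data.List using (List; []; _∷_; _++_; filter)
open import Data.List.Relation.Unary.All using (All; all?)
open import Data.List.Membership.Propositional using (_∈_)
open import Data.List.Membership.DecPropositional ℕ._≟_ using (_∈?_)
open import Data.Product using (_×_)
open import Data.Unit using (⊤)
open import Data.Empty using (⊥)
open import Data.Sum using (_⊎_)
open import Relation.Nullary using (¬_; Dec; yes; no; does; ¬?)
open import Relation.Binary.PropositionalEquality using (_≡_; _≢_; refl; cong)
open import Function.Bundles using (_⇔_)

-- Variables.  Program variables are named by natural numbers.
-- A predicate variable is either an unprimed x (before-value) or a
-- primed x' (after-value).

data V : Set where
  un : ℕ → V
  pr : ℕ → V

base : V → ℕ
base (un x) = x
base (pr x) = x

_≟V_ : (v w : V) → Dec (v ≡ w)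
un x ≟V un y with x ℕ.≟ y
... | yes refl = yes refl
... | no ne    = no λ { refl → ne refl }
un x ≟V pr y = no λ ()
pr x ≟V un y = no λ ()
pr x ≟V pr y with x ℕ.≟ y
... | yes refl = yes refl
... | no ne    = no λ { refl → ne refl }

-- Abstract expressions: variables and applications of (uninterpreted)
-- function symbols (constants are 0-ary symbols).

data Expr (A : Set) : Set where
  var : A → Expr A
  fn  : ℕ → List (Expr A) → Expr A

mutual
  renE : {A B : Set} → (A → B) → Expr A → Expr B
  renE f (var a)   = var (f a)
  renE f (fn g es) = fn g (renEs f es)

  renEs : {A B : Set} → (A → B) → List (Expr A) → List (Expr B)
  renEs f []       = []
  renEs f (e ∷ es) = renE f e ∷ renEs f es

mutual
  fvE : {A : Set} → Expr A → List A
  fvE (var a)   = a ∷ []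
  fvE (fn g es) = fvEs es

  fvEs : {A : Set} → List (Expr A) → List A
  fvEs []       = []
  fvEs (e ∷ es) = fvE e ++ fvEs es

mutual
  substE : (V → Expr V) → Expr V → Expr V
  substE σ (var v)   = σ v
  substE σ (fn g es) = fn g (substEs σ es)

  substEs : (V → Expr V) → List (Expr V) → List (Expr V)
  substEs σ []       = []
  substEs σ (e ∷ es) = substE σ e ∷ substEs σ es

data RelOp : Set where
  eqR  : RelOp
  neqR : RelOp
  relR : ℕ → RelOp

-- General predicates (over primed and unprimed variables).
-- Quantifiers bind unprimed variables.

data Pred : Set where
  atom  : RelOp → Expr V → Expr V → Pred
  ptrue pfalse : Pred
  pnot  : Pred → Pred
  pand por pimp : Pred → Pred → Pred
  pall pex : ℕ → Pred → Pred

fvP : Pred → List V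
fvP (atom r e f) = fvE e ++ fvE f
fvP ptrue        = []
fvP pfalse       = []
fvP (pnot p)     = fvP p
fvP (pand p q)   = fvP p ++ fvP q
fvP (por p q)    = fvP p ++ fvP q
fvP (pimp p q)   = fvP p ++ fvP q
fvP (pall z p)   = filter (λ v → ¬? (v ≟V un z)) (fvP p)
fvP (pex z p)    = filter (λ v → ¬? (v ≟V un z)) (fvP p)

upd : {B : Set} → (V → B) → V → B → V → B
upd σ v b w with w ≟V v
... | yes _ = b
... | no _  = σ w

substP : (V → Expr V) → Pred → Pred
substP σ (atom r e f) = atom r (substE σ e) (substE σ f)
substP σ ptrue        = ptrue
substP σ pfalse       = pfalse
substP σ (pnot p)     = pnot (substP σ p)
substP σ (pand p q)   = pand (substP σ p) (substP σ q)
substP σ (por p q)    = por (substP σ p) (substP σ q)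
substP σ (pimp p q)   = pimp (substP σ p) (substP σ q)
substP σ (pall z p)   = pall z (substP (upd σ (un z) (var (un z))) p)
substP σ (pex z p)    = pex z (substP (upd σ (un z) (var (un z))) p)

-- Guards: negation-free predicates over program variables
-- (the syntax in which CF predicates live).

data Guard : Set where
  gatom : RelOp → Expr ℕ → Expr ℕ → Guard
  gtrue : Guard
  gand gor : Guard → Guard → Guard
  gall gex : ℕ → Guard → Guard

toPred : Guard → Pred
toPred (gatom r e f) = atom r (renE un e) (renE un f)
toPred gtrue         = ptrue
toPred (gand p q)    = pand (toPred p) (toPred q)
toPred (gor p q)     = por (toPred p) (toPred q)
toPred (gall z p)    = pall z (toPred p)
toPred (gex z p)     = pex z (toPred p)

mutual
  data IsConj : Guard → Set where
    c-true : IsConj gtrue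
    c-and  : ∀ {p q} → IsConj p → IsConj q → IsConj (gand p q)
    c-disj : ∀ {p} → IsDisj p → IsConj p

  data IsDisj : Guard → Set where
    d-or  : ∀ {p q} → IsDisj p → IsDisj q → IsDisj (gor p q)
    d-lit : ∀ {p} → IsLit p → IsDisj p

  data IsLit : Guard → Set where
    l-atom : ∀ {r e f} → IsLit (gatom r e f)
    l-all  : ∀ {z p} → IsConj p → IsLit (gall z p)
    l-ex   : ∀ {z p} → IsConj p → IsLit (gex z p)

IsCF : Guard → Set
IsCF = IsConj

data Subst : Set where
  assign  : ℕ → Expr ℕ → Subst
  massign : ℕ → ℕ → Expr ℕ → Expr ℕ → Subst
  skip    : Subst
  guarded : Guard → Subst → Subst
  choice  : Subst → Subst → Subst
  local   : ℕ → Subst → Subst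

data GuardsCF : Subst → Set where
  cf-assign  : ∀ {x e} → GuardsCF (assign x e)
  cf-massign : ∀ {x y e f} → GuardsCF (massign x y e f)
  cf-skip    : GuardsCF skip
  cf-guarded : ∀ {g s} → IsCF g → GuardsCF s → GuardsCF (guarded g s)
  cf-choice  : ∀ {s t} → GuardsCF s → GuardsCF t → GuardsCF (choice s t)
  cf-local   : ∀ {z s} → GuardsCF s → GuardsCF (local z s)

-- well-formedness w.r.t. a postcondition mentioning exactly the
-- variables X (and X'): multiple assignments assign distinct variables,
-- and local variables are not free in the postcondition (side
-- condition of [@z.S]P ⇔ ∀z.[S]P).
data WF (X : List ℕ) : Subst → Set where
  wf-assign  : ∀ {x e} → WF X (assign x e)
  wf-massign : ∀ {x y e f} → x ≢ y → WF X (massign x y e f)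
  wf-skip    : WF X skip
  wf-guarded : ∀ {g s} → WF X s → WF X (guarded g s)
  wf-choice  : ∀ {s t} → WF X s → WF X t → WF X (choice s t)
  wf-local   : ∀ {z s} → ¬ (z ∈ X) → WF X s → WF X (local z s)

idσ : V → Expr V
idσ = var

wp : Subst → Pred → Pred
wp (assign x e) P       = substP (upd idσ (un x) (renE un e)) P
wp (massign x y e f) P  =
  substP (upd (upd idσ (un y) (renE un f)) (un x) (renE un e)) P
wp skip P               = P
wp (guarded g s) P      = pimp (toPred g) (wp s P)
wp (choice s t) P       = pand (wp s P) (wp t P)
wp (local z s) P        = pall z (wp s P)

bigAnd : List ℕ → Pred
bigAnd []       = ptrue
bigAnd (x ∷ xs) = pand (atom eqR (var (un x)) (var (pr x))) (bigAnd xs)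

bigOr : List ℕ → Pred
bigOr []       = pfalse
bigOr (x ∷ xs) = por (atom neqR (var (un x)) (var (pr x))) (bigOr xs)

Prd : List ℕ → Subst → Pred
Prd X S = pnot (wp S (pnot (bigAnd X)))

Mod : List ℕ → Subst → Pred
Mod X S = pand (Prd X S) (bigOr X)

FVin : List ℕ → Pred → Set
FVin X P = All (λ v → base v ∈ X) (fvP P)

subsetB : List ℕ → List ℕ → Bool
subsetB Y X = does (all? (_∈? X) Y)

TG : List ℕ → Guard → Guard
TG X (gatom r e f) =
  if subsetB (fvE e) X ∧ subsetB (fvE f) X then gatom r e f else gtrue
TG X gtrue         = gtrue
TG X (gand p q)    = gand (TG X p) (TG X q)
TG X (gor p q)     = gor (TG X p) (TG X q)
TG X (gall z p)    = gall z (TG (z ∷ X) p)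
TG X (gex z p)     = gex z (TG (z ∷ X) p)

TS : List ℕ → Subst → Subst
TS X (assign x e) = if does (x ∈? X) then assign x e else skip
TS X (massign x y e f) with does (x ∈? X) | does (y ∈? X)
... | true  | true  = massign x y e f
... | true  | false = assign x e
... | false | true  = assign y f
... | false | false = skip
TS X skip          = skip
TS X (guarded g s) = guarded (TG X g) (TS X s)
TS X (choice s t)  = choice (TS X s) (TS X t)
TS X (local z s)   = local z (TS (z ∷ X) s)

record Interp : Set₁ where
  field
    D   : Set
    fun : ℕ → List D → D
    rel : ℕ → D → D → Set

module _ (I : Interp) where
  open Interp I

  mutual
    evalE : (V → D) → Expr V → D
    evalE ρ (var v)   = ρ v
    evalE ρ (fn g es) = fun g (evalEs ρ es)

    evalEs : (V → D) → List (Expr V) → List D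
    evalEs ρ []       = []
    evalEs ρ (e ∷ es) = evalE ρ e ∷ evalEs ρ es

  relSem : RelOp → D → D → Set
  relSem eqR  a b    = a ≡ b
  relSem neqR a b    = ¬ (a ≡ b)
  relSem (relR n) a b = rel n a b

  ⟦_⟧ : Pred → (V → D) → Set
  ⟦ atom r e f ⟧ ρ = relSem r (evalE ρ e) (evalE ρ f)
  ⟦ ptrue ⟧ ρ      = ⊤
  ⟦ pfalse ⟧ ρ     = ⊥
  ⟦ pnot p ⟧ ρ     = ¬ ⟦ p ⟧ ρ
  ⟦ pand p q ⟧ ρ   = ⟦ p ⟧ ρ × ⟦ q ⟧ ρ
  ⟦ por p q ⟧ ρ    = ⟦ p ⟧ ρ ⊎ ⟦ q ⟧ ρ
  ⟦ pimp p q ⟧ ρ   = ⟦ p ⟧ ρ → ⟦ q ⟧ ρ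
  ⟦ pall z p ⟧ ρ   = (d : D) → ⟦ p ⟧ (upd ρ (un z) d)
  ⟦ pex z p ⟧ ρ    = Σ' D (λ d → ⟦ p ⟧ (upd ρ (un z) d))
    where
      open import Data.Product using () renaming (Σ to Σ')

  Equiv : Pred → Pred → Set
  Equiv P Q = (ρ : V → D) → ⟦ P ⟧ ρ ⇔ ⟦ Q ⟧ ρ

-- Every variable of [S]¬⋀(x = x') lies in X.  Hence each guard of S mentions
-- only variables of X (or bound ones) and is left unchanged by T_X, while an
-- assignment to a variable outside X substitutes into a postcondition in which
-- that variable does not occur, so replacing it by skip changes nothing.  Thus
-- [T_X(S)]¬⋀(x = x') and [S]¬⋀(x = x') are the same predicate, syntactically.
module Submission where

open import Defs
open import Level using (0ℓ)
open import Data.Bool using (true)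
open import Data.List using (List; []; _∷_; _++_; filter)
open import Data.List.Relation.Unary.All using (all?; lookup)
import Data.List.Relation.Unary.All as All
open import Data.List.Relation.Unary.All.Properties using (++⁻ˡ)
open import Data.List.Relation.Unary.Any using (here; there)
open import Data.List.Membership.Propositional using (_∈_)
open import Data.List.Membership.Propositional.Properties using (∈-++⁺ˡ; ∈-++⁺ʳ; ∈-++⁻; ∈-filter⁺)
open import Data.Nat using (ℕ; _≟_)
open import Data.List.Membership.DecPropositional _≟_ using (_∈?_)
open import Data.Sum using (_⊎_; inj₁; inj₂; [_,_])
open import Data.Empty using (⊥-elim)
open import Function using (id; _∘_)
open import Function.Bundles using (mk⇔)
open import Axiom.ExcludedMiddle using (ExcludedMiddle)
open import Relation.Nullary using (¬_; yes; no; ¬?)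
open import Relation.Nullary.Decidable using (dec-true)
open import Relation.Binary.PropositionalEquality
  using (_≡_; _≢_; refl; sym; trans; cong; cong₂; subst; module ≡-Reasoning)

Within : List ℕ → List V → Set
Within Y vs = ∀ {v} → v ∈ vs → base v ∈ Y

unbind : ℕ → List V → List V
unbind z = filter (λ v → ¬? (v ≟V un z))

∈-unbind : ∀ z {v} xs → v ∈ xs → v ≡ un z ⊎ v ∈ unbind z xs
∈-unbind z {v} xs v∈xs with v ≟V un z
... | yes v≡z = inj₁ v≡z
... | no  v≢z = inj₂ (∈-filter⁺ (λ w → ¬? (w ≟V un z)) v∈xs v≢z)

Within-unbind : ∀ {Y} z xs → Within Y (unbind z xs) → Within (z ∷ Y) xs
Within-unbind z xs h v∈xs = [ (λ { refl → here refl }) , there ∘ h ] (∈-unbind z xs v∈xs)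

Within-++ˡ : ∀ {Y} xs {ys} → Within Y (xs ++ ys) → Within Y xs
Within-++ˡ xs h = h ∘ ∈-++⁺ˡ

Within-++ʳ : ∀ {Y} xs {ys} → Within Y (xs ++ ys) → Within Y ys
Within-++ʳ xs h = h ∘ ∈-++⁺ʳ xs

outside : ∀ {Y vs v x} → Within Y vs → ¬ x ∈ Y → v ∈ vs → v ≢ un x
outside h x∉Y v∈vs refl = x∉Y (h v∈vs)

Within-bigAnd : ∀ X → Within X (fvP (bigAnd X))
Within-bigAnd (x ∷ X) (here refl)         = here refl
Within-bigAnd (x ∷ X) (there (here refl)) = here refl
Within-bigAnd (x ∷ X) (there (there v∈))  = there (Within-bigAnd X v∈)

upd-≡ : ∀ {B} (σ : V → B) v b → upd σ v b v ≡ b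
upd-≡ σ v b with v ≟V v
... | yes _   = refl
... | no  v≢v = ⊥-elim (v≢v refl)

upd-≢ : ∀ {B} (σ : V → B) {v} b {w} → w ≢ v → upd σ v b w ≡ σ w
upd-≢ σ {v} b {w} w≢v with w ≟V v
... | yes w≡v = ⊥-elim (w≢v w≡v)
... | no  _   = refl

upd-cong : ∀ {B} (σ τ : V → B) v b {w} → σ w ≡ τ w → upd σ v b w ≡ upd τ v b w
upd-cong σ τ v b {w} σw≡τw with w ≟V v
... | yes _ = refl
... | no  _ = σw≡τw

upd-upd-≢ : ∀ {B} (σ : V → B) {u} c v b {w} → w ≢ u → upd (upd σ u c) v b w ≡ upd σ v b w
upd-upd-≢ σ c v b w≢u = upd-cong (upd σ _ c) σ v b (upd-≢ σ c w≢u)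

mutual
  substE-cong : ∀ {σ τ} e → (∀ {v} → v ∈ fvE e → σ v ≡ τ v) → substE σ e ≡ substE τ e
  substE-cong (var v)   agree = agree (here refl)
  substE-cong (fn g es) agree = cong (fn g) (substEs-cong es agree)

  substEs-cong : ∀ {σ τ} es → (∀ {v} → v ∈ fvEs es → σ v ≡ τ v) → substEs σ es ≡ substEs τ es
  substEs-cong []       agree = refl
  substEs-cong (e ∷ es) agree =
    cong₂ _∷_ (substE-cong e (agree ∘ ∈-++⁺ˡ)) (substEs-cong es (agree ∘ ∈-++⁺ʳ (fvE e)))

agree-under-binder : ∀ {σ τ} z p → (∀ {v} → v ∈ unbind z (fvP p) → σ v ≡ τ v) →
  ∀ {v} → v ∈ fvP p → upd σ (un z) (var (un z)) v ≡ upd τ (un z) (var (un z)) v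
agree-under-binder {σ} {τ} z p agree v∈p with ∈-unbind z (fvP p) v∈p
... | inj₁ refl = trans (upd-≡ σ (un z) (var (un z))) (sym (upd-≡ τ (un z) (var (un z))))
... | inj₂ v∈zp = upd-cong σ τ (un z) (var (un z)) (agree v∈zp)

substP-cong : ∀ {σ τ} P → (∀ {v} → v ∈ fvP P → σ v ≡ τ v) → substP σ P ≡ substP τ P
substP-cong (atom r e f) agree =
  cong₂ (atom r) (substE-cong e (agree ∘ ∈-++⁺ˡ)) (substE-cong f (agree ∘ ∈-++⁺ʳ (fvE e)))
substP-cong ptrue      agree = refl
substP-cong pfalse     agree = refl
substP-cong (pnot p)   agree = cong pnot (substP-cong p agree)
substP-cong (pand p q) agree =
  cong₂ pand (substP-cong p (agree ∘ ∈-++⁺ˡ)) (substP-cong q (agree ∘ ∈-++⁺ʳ (fvP p)))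
substP-cong (por p q)  agree =
  cong₂ por (substP-cong p (agree ∘ ∈-++⁺ˡ)) (substP-cong q (agree ∘ ∈-++⁺ʳ (fvP p)))
substP-cong (pimp p q) agree =
  cong₂ pimp (substP-cong p (agree ∘ ∈-++⁺ˡ)) (substP-cong q (agree ∘ ∈-++⁺ʳ (fvP p)))
substP-cong (pall z p) agree = cong (pall z) (substP-cong p (agree-under-binder z p agree))
substP-cong (pex z p)  agree = cong (pex z) (substP-cong p (agree-under-binder z p agree))

upd-var-id : ∀ z v → upd idσ (un z) (var (un z)) v ≡ idσ v
upd-var-id z v with v ≟V un z
... | yes refl = refl
... | no  _    = refl

substP-id : ∀ P → substP idσ P ≡ P
substP-id (atom r e f) = cong₂ (atom r) (substE-id e) (substE-id f)
  where
  mutual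
    substE-id : ∀ e → substE idσ e ≡ e
    substE-id (var v)   = refl
    substE-id (fn g es) = cong (fn g) (substEs-id es)

    substEs-id : ∀ es → substEs idσ es ≡ es
    substEs-id []       = refl
    substEs-id (e ∷ es) = cong₂ _∷_ (substE-id e) (substEs-id es)
substP-id ptrue      = refl
substP-id pfalse     = refl
substP-id (pnot p)   = cong pnot (substP-id p)
substP-id (pand p q) = cong₂ pand (substP-id p) (substP-id q)
substP-id (por p q)  = cong₂ por (substP-id p) (substP-id q)
substP-id (pimp p q) = cong₂ pimp (substP-id p) (substP-id q)
substP-id (pall z p) = cong (pall z) (trans (substP-cong p (λ {v} _ → upd-var-id z v)) (substP-id p))
substP-id (pex z p)  = cong (pex z) (trans (substP-cong p (λ {v} _ → upd-var-id z v)) (substP-id p))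

substP-upd-fresh : ∀ σ {u} b P → (∀ {v} → v ∈ fvP P → v ≢ u) → substP (upd σ u b) P ≡ substP σ P
substP-upd-fresh σ b P fresh = substP-cong P (upd-≢ σ b ∘ fresh)

mutual
  ∈-fvE-renE : ∀ {A B} (f : A → B) e {a} → a ∈ fvE e → f a ∈ fvE (renE f e)
  ∈-fvE-renE f (var a)   (here refl) = here refl
  ∈-fvE-renE f (fn g es) a∈es        = ∈-fvEs-renEs f es a∈es

  ∈-fvEs-renEs : ∀ {A B} (f : A → B) es {a} → a ∈ fvEs es → f a ∈ fvEs (renEs f es)
  ∈-fvEs-renEs f (e ∷ es) a∈ with ∈-++⁻ (fvE e) a∈
  ... | inj₁ a∈e  = ∈-++⁺ˡ (∈-fvE-renE f e a∈e)
  ... | inj₂ a∈es = ∈-++⁺ʳ (fvE (renE f e)) (∈-fvEs-renEs f es a∈es)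

subsetB-complete : ∀ xs Y → (∀ {a} → a ∈ xs → a ∈ Y) → subsetB xs Y ≡ true
subsetB-complete xs Y xs⊆Y = dec-true (all? (_∈? Y) xs) (All.tabulate xs⊆Y)

TG-id : ∀ Y g → Within Y (fvP (toPred g)) → TG Y g ≡ g
TG-id Y (gatom r e f) h
  rewrite subsetB-complete (fvE e) Y (h ∘ ∈-++⁺ˡ ∘ ∈-fvE-renE un e)
        | subsetB-complete (fvE f) Y (h ∘ ∈-++⁺ʳ (fvE (renE un e)) ∘ ∈-fvE-renE un f) = refl
TG-id Y gtrue      h = refl
TG-id Y (gand p q) h =
  cong₂ gand (TG-id Y p (Within-++ˡ (fvP (toPred p)) h)) (TG-id Y q (Within-++ʳ (fvP (toPred p)) h))
TG-id Y (gor p q)  h =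
  cong₂ gor (TG-id Y p (Within-++ˡ (fvP (toPred p)) h)) (TG-id Y q (Within-++ʳ (fvP (toPred p)) h))
TG-id Y (gall z p) h = cong (gall z) (TG-id (z ∷ Y) p (Within-unbind z (fvP (toPred p)) h))
TG-id Y (gex z p)  h = cong (gex z) (TG-id (z ∷ Y) p (Within-unbind z (fvP (toPred p)) h))

wp-TS : ∀ Y S P → Within Y (fvP P) → Within Y (fvP (wp S P)) → wp (TS Y S) P ≡ wp S P
wp-TS Y (assign x e) P hP h with x ∈? Y
... | yes _   = refl
... | no  x∉Y = sym (trans (substP-upd-fresh idσ (renE un e) P (outside hP x∉Y)) (substP-id P))
wp-TS Y (massign x y e f) P hP h with x ∈? Y | y ∈? Y
... | yes _   | yes _   = refl
... | yes _   | no  y∉Y =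
  sym (substP-cong P (upd-upd-≢ idσ (renE un f) (un x) (renE un e) ∘ outside hP y∉Y))
... | no  x∉Y | yes _   = sym (substP-upd-fresh σy (renE un e) P (outside hP x∉Y))
  where σy = upd idσ (un y) (renE un f)
... | no  x∉Y | no  y∉Y = sym (begin
    substP (upd σy (un x) (renE un e)) P ≡⟨ substP-upd-fresh σy (renE un e) P (outside hP x∉Y) ⟩
    substP σy P                           ≡⟨ substP-upd-fresh idσ (renE un f) P (outside hP y∉Y) ⟩
    substP idσ P                          ≡⟨ substP-id P ⟩
    P                                     ∎)
  where σy = upd idσ (un y) (renE un f); open ≡-Reasoning
wp-TS Y skip          P hP h = refl
wp-TS Y (guarded g s) P hP h =
  cong₂ pimp (cong toPred (TG-id Y g (Within-++ˡ (fvP (toPred g)) h)))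
             (wp-TS Y s P hP (Within-++ʳ (fvP (toPred g)) h))
wp-TS Y (choice s t)  P hP h =
  cong₂ pand (wp-TS Y s P hP (Within-++ˡ (fvP (wp s P)) h))
             (wp-TS Y t P hP (Within-++ʳ (fvP (wp s P)) h))
wp-TS Y (local z s)   P hP h =
  cong (pall z) (wp-TS (z ∷ Y) s P (there ∘ hP) (Within-unbind z (fvP (wp s P)) h))

Prd-TS : ∀ X S → Within X (fvP (Prd X S)) → Prd X (TS X S) ≡ Prd X S
Prd-TS X S h = cong pnot (wp-TS X S (pnot (bigAnd X)) (Within-bigAnd X) h)

theorem3 : ExcludedMiddle 0ℓ →
    (I : Interp) (X : List ℕ) (S : Subst) →
    GuardsCF S → WF X S → FVin X (Mod X S) →
    Equiv I (Prd X S) (Prd X (TS X S))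
theorem3 _ I X S _ _ fv-Mod =
  subst (Equiv I (Prd X S)) (sym (Prd-TS X S fv-Prd)) (λ _ → mk⇔ id id)
  where
  fv-Prd : Within X (fvP (Prd X S))
  fv-Prd = lookup (++⁻ˡ (fvP (Prd X S)) fv-Mod)
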